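{- Let $n$ and $k$ be positive integers with $\gcd(k,n)=1$. Then $r_k(n)\equiv 0 \pmod{k}$.
   Context: $r_k(n)$ is the number of representations of $n$ as an ordered sum of $k$ squares of integers (signs and order counted). -}

module Defs where

open import Data.Nat using (ℕ; zero; suc)
open import Data.Integer as ℤ using (ℤ; +_; -_)
open import Data.List using (List; []; _∷_; map; concatMap; length; filter; upTo)
open import Data.Vec using (Vec; []; _∷_; foldr)
open import Relation.Binary.PropositionalEquality using (_≡_)
open import Data.Integer.Properties using () renaming (_≟_ to _≟ℤ_)

intsUpTo : ℕ → List ℤ
intsUpTo b = map (λ i → - (+ i)) (upTo (suc b)) Data.List.++ map (λ i → + suc i) (upTo b)

box : (k b : ℕ) → List (Vec ℤ k)
box zero    b = [] ∷ []
box (suc k) b = concatMap (λ x → map (x ∷_) (box k b)) (intsUpTo b)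

sumSq : ∀ {k} → Vec ℤ k → ℤ
sumSq = foldr _ (λ x s → x ℤ.* x ℤ.+ s) (+ 0)

-- r k n : number of (x₁,…,x_k) ∈ ℤ^k with x₁² + … + x_k² = n
-- (signs and order counted).  Any solution satisfies |xᵢ| ≤ n,
-- so it suffices to count inside the box [-n, n]^k, which is
-- enumerated without repetition.
r : ℕ → ℕ → ℕ
r k n = length (filter (λ v → sumSq v ≟ℤ + n) (box k n))

-- Rotating the coordinates, (x₀, …, x_{k-1}) ↦ (x₁, …, x_{k-1}, x₀), permutes the
-- representations of n, and on a representation it lowers the moment Σᵢ i·xᵢ² by n
-- modulo k.  So the number of representations with moment ≡ -t (mod k) is unchanged by
-- t ↦ t + n as well as by t ↦ t + k; as gcd k n = 1 it does not depend on t at all, and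
-- summing over the k residues gives r k n = k · (that number).
{-# OPTIONS --safe #-}
module Submission where

open import Defs
open import Data.Nat using (ℕ; _%_; _≥_; zero; suc)
open import Data.Nat.GCD using (gcd)
open import Data.Nat.Divisibility using (_∣_)
open import Relation.Binary.PropositionalEquality using (_≡_)

open import Level using (Level)
open import Function using (_∘_; _⇔_; mk⇔)
open import Data.Bool using (true; false; if_then_else_)
open import Data.Nat using (_+_; _*_; _<_; _≟_; NonZero; s<s)
open import Data.Nat.Properties
  using (+-identityʳ; +-assoc; +-comm; +-suc; *-zeroʳ; *-identityʳ; *-comm; +-commutativeSemigroup)
open import Algebra.Properties.CommutativeSemigroup +-commutativeSemigroup using (interchange)
open import Data.Nat.DivMod using ([m+n]%n≡m%n; [m+kn]%n≡m%n; m<n⇒m%n≡m; %-distribˡ-+)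
open import Data.Nat.GCD using (module Bézout)
open import Data.Nat.Coprimality using (Coprime; coprime⇒GCD≡1; gcd≡1⇒coprime)
open import Data.Nat.Divisibility using (divides)
open import Data.Nat.ListAction using (sum)
open import Data.Nat.ListAction.Properties using (sum-++)
open import Data.Nat.Tactic.RingSolver using (solve-∀)
open import Data.Integer as ℤ using (ℤ; -[1+_]; ∣_∣)
open import Data.Integer.Properties using (+◃n≡+n; +-injective) renaming (_≟_ to _≟ℤ_)
open import Data.List using (List; []; _∷_; map; concatMap; length; filter; _++_; upTo)
open import Data.List.Properties
  using (map-cong; map-cong-local; map-∘; map-++; map-applyUpTo; map-upTo; upTo-∷ʳ; length-upTo)
open import Data.List.Relation.Unary.All as All using (All)
open import Data.List.Relation.Unary.All.Properties using (all-upTo; all-filter)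
open import Data.Vec using (Vec; []; _∷_; _∷ʳ_)
open import Relation.Nullary using (Dec; does)
open import Relation.Nullary.Decidable using (does-⇔)
open import Relation.Unary using (Pred; Decidable)
open import Relation.Binary.PropositionalEquality
  using (refl; sym; trans; cong; cong₂; _≗_; module ≡-Reasoning)

open ≡-Reasoning

private
  variable
    ℓ : Level
    A B : Set

∑ : List A → (A → ℕ) → ℕ
∑ xs f = sum (map f xs)

𝟙 : {P : Set ℓ} → Dec P → ℕ
𝟙 P? = if does P? then 1 else 0

∑-cong : ∀ (xs : List A) {f g : A → ℕ} → f ≗ g → ∑ xs f ≡ ∑ xs g
∑-cong xs f≗g = cong sum (map-cong f≗g xs)

∑-cong-local : ∀ {xs : List A} {f g : A → ℕ} → All (λ x → f x ≡ g x) xs → ∑ xs f ≡ ∑ xs g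
∑-cong-local eqs = cong sum (map-cong-local eqs)

∑-map : ∀ (h : A → B) xs f → ∑ (map h xs) f ≡ ∑ xs (f ∘ h)
∑-map h xs f = cong sum (sym (map-∘ xs))

∑-++ : ∀ (xs ys : List A) f → ∑ (xs ++ ys) f ≡ ∑ xs f + ∑ ys f
∑-++ xs ys f = trans (cong sum (map-++ f xs ys)) (sum-++ (map f xs) (map f ys))

∑-concatMap : ∀ (g : A → List B) xs f → ∑ (concatMap g xs) f ≡ ∑ xs (λ x → ∑ (g x) f)
∑-concatMap g []       f = refl
∑-concatMap g (x ∷ xs) f =
  trans (∑-++ (g x) (concatMap g xs) f) (cong (∑ (g x) f +_) (∑-concatMap g xs f))

∑-const : ∀ (xs : List A) c → ∑ xs (λ _ → c) ≡ length xs * c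
∑-const []       c = refl
∑-const (x ∷ xs) c = cong (c +_) (∑-const xs c)

∑-distrib-+ : ∀ (xs : List A) f g → ∑ xs (λ x → f x + g x) ≡ ∑ xs f + ∑ xs g
∑-distrib-+ []       f g = refl
∑-distrib-+ (x ∷ xs) f g =
  trans (cong (f x + g x +_) (∑-distrib-+ xs f g)) (interchange (f x) (g x) _ _)

∑-comm : ∀ (xs : List A) (ys : List B) (F : A → B → ℕ) →
         ∑ xs (λ x → ∑ ys (F x)) ≡ ∑ ys (λ y → ∑ xs (λ x → F x y))
∑-comm []       ys F = sym (trans (∑-const ys 0) (*-zeroʳ (length ys)))
∑-comm (x ∷ xs) ys F =
  trans (cong (∑ ys (F x) +_) (∑-comm xs ys F)) (sym (∑-distrib-+ ys (F x) _))

∑-filter : ∀ {P : Pred A ℓ} (P? : Decidable P) xs f →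
           ∑ (filter P? xs) f ≡ ∑ xs (λ x → if does (P? x) then f x else 0)
∑-filter P? []       f = refl
∑-filter P? (x ∷ xs) f with does (P? x)
... | true  = cong (f x +_) (∑-filter P? xs f)
... | false = ∑-filter P? xs f

∑-filter-invariant : ∀ {P : Pred A ℓ} (P? : Decidable P) (ρ : A → A) xs →
                     (∀ x → P (ρ x) ⇔ P x) → (∀ f → ∑ xs (f ∘ ρ) ≡ ∑ xs f) →
                     ∀ f → ∑ (filter P? xs) (f ∘ ρ) ≡ ∑ (filter P? xs) f
∑-filter-invariant P? ρ xs ρ-preserves ρ-invariant f = begin
  ∑ (filter P? xs) (f ∘ ρ)                             ≡⟨ ∑-filter P? xs (f ∘ ρ) ⟩
  ∑ xs (λ x → if does (P? x) then f (ρ x) else 0)      ≡⟨ ∑-cong xs does-ρ ⟩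
  ∑ xs (λ x → if does (P? (ρ x)) then f (ρ x) else 0)  ≡⟨ ρ-invariant _ ⟩
  ∑ xs (λ x → if does (P? x) then f x else 0)          ≡⟨ ∑-filter P? xs f ⟨
  ∑ (filter P? xs) f                                   ∎
  where
  does-ρ : ∀ x → (if does (P? x) then f (ρ x) else 0) ≡ (if does (P? (ρ x)) then f (ρ x) else 0)
  does-ρ x = cong (λ b → if b then f (ρ x) else 0) (sym (does-⇔ (ρ-preserves x) (P? (ρ x)) (P? x)))

∑-upTo-suc : ∀ m (f : ℕ → ℕ) → ∑ (upTo (suc m)) f ≡ f 0 + ∑ (upTo m) (f ∘ suc)
∑-upTo-suc m f =
  cong (λ ys → f 0 + sum ys) (trans (map-applyUpTo suc f m) (sym (map-upTo (f ∘ suc) m)))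

∑-upTo-∷ʳ : ∀ m (f : ℕ → ℕ) → ∑ (upTo (suc m)) f ≡ ∑ (upTo m) f + f m
∑-upTo-∷ʳ m f = begin
  ∑ (upTo (suc m)) f            ≡⟨ cong (λ ts → ∑ ts f) (upTo-∷ʳ m) ⟨
  ∑ (upTo m ++ m ∷ []) f        ≡⟨ ∑-++ (upTo m) (m ∷ []) f ⟩
  ∑ (upTo m) f + (f m + 0)      ≡⟨ cong (∑ (upTo m) f +_) (+-identityʳ (f m)) ⟩
  ∑ (upTo m) f + f m            ∎

∑-upTo-window-suc : ∀ (g : ℕ → ℕ) k → (∀ t → g (t + k) ≡ g t) →
                    ∀ a → ∑ (upTo k) (λ t → g (suc a + t)) ≡ ∑ (upTo k) (λ t → g (a + t))
∑-upTo-window-suc g zero    periodic a = refl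
∑-upTo-window-suc g (suc m) periodic a = begin
  ∑ (upTo (suc m)) (λ t → g (suc a + t))            ≡⟨ ∑-upTo-∷ʳ m _ ⟩
  ∑ (upTo m) (λ t → g (suc a + t)) + g (suc a + m)  ≡⟨ cong₂ _+_ (∑-cong (upTo m) shift-inner) wrap-around ⟩
  ∑ (upTo m) (λ t → g (a + suc t)) + g (a + 0)      ≡⟨ +-comm _ (g (a + 0)) ⟩
  g (a + 0) + ∑ (upTo m) (λ t → g (a + suc t))      ≡⟨ ∑-upTo-suc m (λ t → g (a + t)) ⟨
  ∑ (upTo (suc m)) (λ t → g (a + t))                ∎
  where
  shift-inner : ∀ t → g (suc a + t) ≡ g (a + suc t)
  shift-inner t = cong g (sym (+-suc a t))

  wrap-around : g (suc a + m) ≡ g (a + 0)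
  wrap-around = trans (cong g (+-suc-period a m)) (periodic (a + 0))
    where
    +-suc-period : ∀ a m → suc a + m ≡ a + 0 + suc m
    +-suc-period = solve-∀

∑-upTo-window : ∀ (g : ℕ → ℕ) k → (∀ t → g (t + k) ≡ g t) →
                ∀ a → ∑ (upTo k) (λ t → g (a + t)) ≡ ∑ (upTo k) g
∑-upTo-window g k periodic zero    = refl
∑-upTo-window g k periodic (suc a) =
  trans (∑-upTo-window-suc g k periodic a) (∑-upTo-window g k periodic a)

∑-upTo-multiple≡1 : ∀ k .{{_ : NonZero k}} a → ∑ (upTo k) (λ t → 𝟙 ((a + t) % k ≟ 0)) ≡ 1
∑-upTo-multiple≡1 k@(suc m) a = begin
  ∑ (upTo k) (λ t → 𝟙 ((a + t) % k ≟ 0))        ≡⟨ ∑-upTo-window (λ t → 𝟙 (t % k ≟ 0)) k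
                                                     (λ t → cong (λ s → 𝟙 (s ≟ 0)) ([m+n]%n≡m%n t k)) a ⟩
  ∑ (upTo k) (λ t → 𝟙 (t % k ≟ 0))              ≡⟨ ∑-upTo-suc m (λ t → 𝟙 (t % k ≟ 0)) ⟩
  1 + ∑ (upTo m) (λ t → 𝟙 (suc t % k ≟ 0))      ≡⟨ cong (1 +_) (∑-cong-local (All.map positive (all-upTo m))) ⟩
  1 + ∑ (upTo m) (λ _ → 0)                      ≡⟨ cong (1 +_) (trans (∑-const (upTo m) 0) (*-zeroʳ (length (upTo m)))) ⟩
  1                                             ∎
  where
  positive : ∀ {t} → t < m → 𝟙 (suc t % k ≟ 0) ≡ 0
  positive t<m = cong (λ s → 𝟙 (s ≟ 0)) (m<n⇒m%n≡m (s<s t<m))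

periodic-* : ∀ (h : ℕ → A) {p} → (∀ t → h (t + p) ≡ h t) → ∀ x t → h (t + x * p) ≡ h t
periodic-* h     periodic zero    t = cong h (+-identityʳ t)
periodic-* h {p} periodic (suc x) t =
  trans (cong h (sym (+-assoc t p (x * p)))) (trans (periodic-* h periodic x (t + p)) (periodic t))

coprime-periods⇒constant : ∀ (h : ℕ → A) {k n} → Coprime k n →
                           (∀ t → h (t + k) ≡ h t) → (∀ t → h (t + n) ≡ h t) → ∀ t → h t ≡ h 0
coprime-periods⇒constant h {k} {n} coprime periodicₖ periodicₙ = constant
  where
  step : ∀ t → h (suc t) ≡ h t
  step t with Bézout.identity (coprime⇒GCD≡1 coprime)
  ... | Bézout.+- x y 1+yn≡xk = begin
    h (suc t)            ≡⟨ periodic-* h periodicₙ y (suc t) ⟨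
    h (suc t + y * n)    ≡⟨ cong h (sym (+-suc t (y * n))) ⟩
    h (t + (1 + y * n))  ≡⟨ cong (λ s → h (t + s)) 1+yn≡xk ⟩
    h (t + x * k)        ≡⟨ periodic-* h periodicₖ x t ⟩
    h t                  ∎
  ... | Bézout.-+ x y 1+xk≡yn = begin
    h (suc t)            ≡⟨ periodic-* h periodicₖ x (suc t) ⟨
    h (suc t + x * k)    ≡⟨ cong h (sym (+-suc t (x * k))) ⟩
    h (t + (1 + x * k))  ≡⟨ cong (λ s → h (t + s)) 1+xk≡yn ⟩
    h (t + y * n)        ≡⟨ periodic-* h periodicₙ y t ⟩
    h t                  ∎

  constant : ∀ t → h t ≡ h 0
  constant zero    = refl
  constant (suc t) = trans (step t) (constant t)

%-cong-+ʳ : ∀ {a b} t k .{{_ : NonZero k}} → a % k ≡ b % k → (a + t) % k ≡ (b + t) % k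
%-cong-+ʳ {a} {b} t k a≡b = begin
  (a + t) % k              ≡⟨ %-distribˡ-+ a t k ⟩
  (a % k + t % k) % k      ≡⟨ cong (λ s → (s + t % k) % k) a≡b ⟩
  (b % k + t % k) % k      ≡⟨ %-distribˡ-+ b t k ⟨
  (b + t) % k              ∎

module ShiftedWeight
  (ys : List A) (ρ : A → A) (w : A → ℕ) (k n : ℕ) .{{_ : NonZero k}} (coprime : Coprime k n)
  (ρ-invariant : ∀ f → ∑ ys (f ∘ ρ) ≡ ∑ ys f)
  (ρ-shifts-w : All (λ y → (w (ρ y) + n) % k ≡ w y % k) ys)
  where

  count : ℕ → ℕ
  count t = ∑ ys (λ y → 𝟙 ((w y + t) % k ≟ 0))

  count-+k : ∀ t → count (t + k) ≡ count t
  count-+k t = ∑-cong ys λ y → cong (λ s → 𝟙 (s ≟ 0))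
    (trans (cong (_% k) (sym (+-assoc (w y) t k))) ([m+n]%n≡m%n (w y + t) k))

  count-+n : ∀ t → count (t + n) ≡ count t
  count-+n t = begin
    count (t + n)                                  ≡⟨ ρ-invariant _ ⟨
    ∑ ys (λ y → 𝟙 ((w (ρ y) + (t + n)) % k ≟ 0))  ≡⟨ ∑-cong-local (All.map shifted ρ-shifts-w) ⟩
    count t                                        ∎
    where
    shifted : ∀ {y} → (w (ρ y) + n) % k ≡ w y % k →
              𝟙 ((w (ρ y) + (t + n)) % k ≟ 0) ≡ 𝟙 ((w y + t) % k ≟ 0)
    shifted {y} eq = cong (λ s → 𝟙 (s ≟ 0))
      (trans (cong (_% k) (swap (w (ρ y)) t n)) (%-cong-+ʳ t k eq))
      where
      swap : ∀ a t n → a + (t + n) ≡ a + n + t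
      swap = solve-∀

  length≡k*count : length ys ≡ k * count 0
  length≡k*count = begin
    length ys                                              ≡⟨ *-identityʳ (length ys) ⟨
    length ys * 1                                          ≡⟨ ∑-const ys 1 ⟨
    ∑ ys (λ _ → 1)                                         ≡⟨ ∑-cong ys (λ y → sym (∑-upTo-multiple≡1 k (w y))) ⟩
    ∑ ys (λ y → ∑ (upTo k) (λ t → 𝟙 ((w y + t) % k ≟ 0)))  ≡⟨ ∑-comm ys (upTo k) _ ⟩
    ∑ (upTo k) count                                       ≡⟨ ∑-cong (upTo k) count-constant ⟩
    ∑ (upTo k) (λ _ → count 0)                             ≡⟨ ∑-const (upTo k) (count 0) ⟩
    length (upTo k) * count 0                              ≡⟨ cong (_* count 0) (length-upTo k) ⟩
    k * count 0                                            ∎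
    where
    count-constant : ∀ t → count t ≡ count 0
    count-constant = coprime-periods⇒constant count coprime count-+k count-+n

  ∣length : k ∣ length ys
  ∣length = divides (count 0) (trans length≡k*count (*-comm k (count 0)))

rotate : ∀ {m} → Vec A (suc m) → Vec A (suc m)
rotate (x ∷ xs) = xs ∷ʳ x

∑-box-∷ : ∀ k b f → ∑ (box (suc k) b) f ≡ ∑ (intsUpTo b) (λ x → ∑ (box k b) (λ v → f (x ∷ v)))
∑-box-∷ k b f = trans (∑-concatMap (λ x → map (x ∷_) (box k b)) (intsUpTo b) f)
                      (∑-cong (intsUpTo b) λ x → ∑-map (x ∷_) (box k b) f)

∑-box-∷ʳ : ∀ k b f → ∑ (box (suc k) b) f ≡ ∑ (box k b) (λ v → ∑ (intsUpTo b) (λ x → f (v ∷ʳ x)))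
∑-box-∷ʳ zero    b f = begin
  ∑ (box 1 b) f                             ≡⟨ ∑-box-∷ zero b f ⟩
  ∑ (intsUpTo b) (λ x → f (x ∷ []) + 0)     ≡⟨ ∑-cong (intsUpTo b) (λ x → +-identityʳ _) ⟩
  ∑ (intsUpTo b) (λ x → f (x ∷ []))         ≡⟨ +-identityʳ _ ⟨
  ∑ (intsUpTo b) (λ x → f (x ∷ [])) + 0     ∎
∑-box-∷ʳ (suc k) b f = begin
  ∑ (box (suc (suc k)) b) f
    ≡⟨ ∑-box-∷ (suc k) b f ⟩
  ∑ (intsUpTo b) (λ y → ∑ (box (suc k) b) (λ v → f (y ∷ v)))
    ≡⟨ ∑-cong (intsUpTo b) (λ y → ∑-box-∷ʳ k b (λ v → f (y ∷ v))) ⟩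
  ∑ (intsUpTo b) (λ y → ∑ (box k b) (λ v → ∑ (intsUpTo b) (λ x → f (y ∷ (v ∷ʳ x)))))
    ≡⟨ ∑-box-∷ k b (λ v → ∑ (intsUpTo b) (λ x → f (v ∷ʳ x))) ⟨
  ∑ (box (suc k) b) (λ v → ∑ (intsUpTo b) (λ x → f (v ∷ʳ x)))
    ∎

∑-box-rotate : ∀ k b f → ∑ (box (suc k) b) (f ∘ rotate) ≡ ∑ (box (suc k) b) f
∑-box-rotate k b f = begin
  ∑ (box (suc k) b) (f ∘ rotate)                                        ≡⟨ ∑-box-∷ k b (f ∘ rotate) ⟩
  ∑ (intsUpTo b) (λ x → ∑ (box k b) (λ v → f (v ∷ʳ x)))                ≡⟨ ∑-comm (intsUpTo b) (box k b) _ ⟩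
  ∑ (box k b) (λ v → ∑ (intsUpTo b) (λ x → f (v ∷ʳ x)))                ≡⟨ ∑-box-∷ʳ k b f ⟨
  ∑ (box (suc k) b) f                                                   ∎

sq : ℤ → ℕ
sq x = ∣ x ∣ * ∣ x ∣

x*x≡+sq : ∀ x → x ℤ.* x ≡ ℤ.+ sq x
x*x≡+sq (ℤ.+ n)  = +◃n≡+n (n * n)
x*x≡+sq -[1+ n ] = +◃n≡+n (suc n * suc n)

sumSqℕ : ∀ {m} → Vec ℤ m → ℕ
sumSqℕ []       = 0
sumSqℕ (x ∷ xs) = sq x + sumSqℕ xs

sumSq≡+sumSqℕ : ∀ {m} (v : Vec ℤ m) → sumSq v ≡ ℤ.+ sumSqℕ v
sumSq≡+sumSqℕ []       = refl
sumSq≡+sumSqℕ (x ∷ xs) = cong₂ ℤ._+_ (x*x≡+sq x) (sumSq≡+sumSqℕ xs)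

sumSqℕ-∷ʳ : ∀ {m} (xs : Vec ℤ m) x → sumSqℕ (xs ∷ʳ x) ≡ sumSqℕ xs + sq x
sumSqℕ-∷ʳ []       x = +-comm (sq x) 0
sumSqℕ-∷ʳ (y ∷ xs) x = trans (cong (sq y +_) (sumSqℕ-∷ʳ xs x)) (sym (+-assoc (sq y) _ _))

sumSq-rotate : ∀ {m} (v : Vec ℤ (suc m)) → sumSq (rotate v) ≡ sumSq v
sumSq-rotate v@(x ∷ xs) = begin
  sumSq (rotate v)            ≡⟨ sumSq≡+sumSqℕ (rotate v) ⟩
  ℤ.+ sumSqℕ (xs ∷ʳ x)        ≡⟨ cong ℤ.+_ (trans (sumSqℕ-∷ʳ xs x) (+-comm (sumSqℕ xs) (sq x))) ⟩
  ℤ.+ sumSqℕ v                ≡⟨ sumSq≡+sumSqℕ v ⟨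
  sumSq v                     ∎

-- moment (x₀ ∷ … ∷ x_{m-1}) = Σᵢ i · xᵢ²
moment : ∀ {m} → Vec ℤ m → ℕ
moment []       = 0
moment (x ∷ xs) = moment xs + sumSqℕ xs

moment-∷ʳ : ∀ {m} (xs : Vec ℤ m) x → moment (xs ∷ʳ x) ≡ moment xs + m * sq x
moment-∷ʳ []               x = refl
moment-∷ʳ {suc m} (y ∷ xs) x = begin
  moment (xs ∷ʳ x) + sumSqℕ (xs ∷ʳ x)           ≡⟨ cong₂ _+_ (moment-∷ʳ xs x) (sumSqℕ-∷ʳ xs x) ⟩
  moment xs + m * sq x + (sumSqℕ xs + sq x)     ≡⟨ regroup (moment xs) (sumSqℕ xs) m (sq x) ⟩
  moment xs + sumSqℕ xs + suc m * sq x          ∎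
  where
  regroup : ∀ a b m s → a + m * s + (b + s) ≡ a + b + suc m * s
  regroup = solve-∀

-- x moves from index 0 to index m, every other entry moves down by one.
moment-rotate : ∀ {m} x (xs : Vec ℤ m) →
                moment (rotate (x ∷ xs)) + sumSqℕ (x ∷ xs) ≡ moment (x ∷ xs) + sq x * suc m
moment-rotate {m} x xs = begin
  moment (xs ∷ʳ x) + (sq x + sumSqℕ xs)          ≡⟨ cong (_+ (sq x + sumSqℕ xs)) (moment-∷ʳ xs x) ⟩
  moment xs + m * sq x + (sq x + sumSqℕ xs)      ≡⟨ regroup (moment xs) (sumSqℕ xs) m (sq x) ⟩
  moment xs + sumSqℕ xs + sq x * suc m           ∎
  where
  regroup : ∀ a b m s → a + m * s + (s + b) ≡ a + b + s * suc m
  regroup = solve-∀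

rotate-shifts-moment : ∀ {m n} (v : Vec ℤ (suc m)) → sumSq v ≡ ℤ.+ n →
                       (moment (rotate v) + n) % suc m ≡ moment v % suc m
rotate-shifts-moment {m} {n} v@(x ∷ xs) sumSq≡n = begin
  (moment (rotate v) + n) % suc m              ≡⟨ cong (λ s → (moment (rotate v) + s) % suc m) n≡sumSqℕ ⟩
  (moment (rotate v) + sumSqℕ v) % suc m       ≡⟨ cong (_% suc m) (moment-rotate x xs) ⟩
  (moment v + sq x * suc m) % suc m            ≡⟨ [m+kn]%n≡m%n (moment v) (sq x) (suc m) ⟩
  moment v % suc m                             ∎
  where
  n≡sumSqℕ : n ≡ sumSqℕ v
  n≡sumSqℕ = +-injective (trans (sym sumSq≡n) (sumSq≡+sumSqℕ v))

mainTheorem20 : (n k : ℕ) → n ≥ 1 → k ≥ 1 → gcd k n ≡ 1 → k ∣ r k n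
mainTheorem20 n zero    _ () _
mainTheorem20 n (suc m) _ _  gcd≡1 =
  ShiftedWeight.∣length solutions rotate moment (suc m) n (gcd≡1⇒coprime gcd≡1)
    (∑-filter-invariant isSolution rotate (box (suc m) n) rotate-preserves (∑-box-rotate m n))
    (All.map (λ {v} → rotate-shifts-moment v) (all-filter isSolution (box (suc m) n)))
  where
  isSolution : (v : Vec ℤ (suc m)) → Dec (sumSq v ≡ ℤ.+ n)
  isSolution v = sumSq v ≟ℤ ℤ.+ n

  solutions : List (Vec ℤ (suc m))
  solutions = filter isSolution (box (suc m) n)

  rotate-preserves : ∀ v → (sumSq (rotate v) ≡ ℤ.+ n) ⇔ (sumSq v ≡ ℤ.+ n)
  rotate-preserves v = mk⇔ (trans (sym (sumSq-rotate v))) (trans (sumSq-rotate v))
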